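{- Let $n\geq 1$, let $\mathcal{H}$ be a non-empty hereditary sub-family of $2^{[n]}$ with $\mathcal{H}\neq\{\emptyset\}$, let $k\geq n+1$, and let $\mathcal{S}$ be a largest star of $\mathcal{H}$. Suppose that for every choice of cross-intersecting sub-families $\mathcal{B}_1,\dots,\mathcal{B}_k$ of $\mathcal{H}$ one has $\sum_{i=1}^k|\mathcal{B}_i|\leq k|\mathcal{S}|$ (i.e. the sum of sizes is maximised by $\mathcal{B}_1=\dots=\mathcal{B}_k=\mathcal{S}$). Then for every choice of cross-intersecting sub-families $\mathcal{A}_1,\dots,\mathcal{A}_k$ of $\mathcal{H}$ one has $\prod_{i=1}^k|\mathcal{A}_i|\leq|\mathcal{S}|^k$; that is, the product of sizes is maximum when $\mathcal{A}_1=\dots=\mathcal{A}_k=\mathcal{S}$.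
   Context: $[n]=\{1,\dots,n\}$ and $2^{[n]}$ is its power set. A family $\mathcal{H}$ is hereditary if all subsets of any set in $\mathcal{H}$ are in $\mathcal{H}$. For $x\in[n]$, the star $\mathcal{H}\langle x\rangle=\{H\in\mathcal{H}:x\in H\}$; a largest star is a star $\mathcal{H}\langle x\rangle$ ($x\in[n]$) of maximum size. Families $\mathcal{A}_1,\dots,\mathcal{A}_k$ (not necessarily distinct or non-empty) are cross-intersecting if for all $i\neq j$ in $[k]$, every set in $\mathcal{A}_i$ intersects every set in $\mathcal{A}_j$. -}

module Defs where

open import Data.Bool using (Bool; true; false; _∧_; if_then_else_)
open import Data.Nat using (ℕ; zero; suc; _≤_; _*_; _+_)
open import Data.Fin using (Fin)
open import Data.Fin.Subset using (Subset; _⊆_; _∩_; Nonempty; _∈_)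
open import Data.Vec using (Vec; []; _∷_; lookup)
open import Data.List using (List; []; _∷_; map; _++_; allFin)
open import Data.Nat.ListAction using (sum; product)
open import Data.Product using (_×_; Σ)
open import Relation.Binary.PropositionalEquality using (_≡_; _≢_)

-- A family of subsets of [n] (here [n] is Fin n), given by its
-- characteristic function on 2^[n].
Family : ℕ → Set
Family n = Subset n → Bool

-- Enumeration of all of 2^[n] (each subset exactly once).
allSubsets : (n : ℕ) → List (Subset n)
allSubsets zero = [] ∷ []
allSubsets (suc n) = map (false ∷_) (allSubsets n) ++ map (true ∷_) (allSubsets n)

size : {n : ℕ} → Family n → ℕ
size {n} F = sum (map (λ X → if F X then 1 else 0) (allSubsets n))

SubFamily : {n : ℕ} → Family n → Family n → Set
SubFamily A H = ∀ X → A X ≡ true → H X ≡ true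

Hereditary : {n : ℕ} → Family n → Set
Hereditary H = ∀ A B → B ⊆ A → H A ≡ true → H B ≡ true

star : {n : ℕ} → Family n → Fin n → Family n
star H x X = H X ∧ lookup X x

IsLargestStar : {n : ℕ} → Family n → Fin n → Set
IsLargestStar H x = ∀ y → size (star H y) ≤ size (star H x)

CrossIntersecting : {n k : ℕ} → (Fin k → Family n) → Set
CrossIntersecting {n} {k} A =
  ∀ (i j : Fin k) → i ≢ j → ∀ X Y → A i X ≡ true → A j Y ≡ true → Nonempty (X ∩ Y)

sumFin : {k : ℕ} → (Fin k → ℕ) → ℕ
sumFin {k} f = sum (map f (allFin k))

prodFin : {k : ℕ} → (Fin k → ℕ) → ℕ
prodFin {k} f = product (map f (allFin k))

module Submission where

open import Defs
open import Data.Bool using (true)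
open import Data.Nat using (ℕ; zero; suc; _≤_; _<_; _<?_; _*_; _^_; _+_)
open import Data.Nat.Properties
open import Data.Nat.ListAction using (sum; product)
open import Data.Nat.ListAction.Properties using (sum-↭; product-↭)
open import Data.Fin using (Fin)
open import Data.Fin.Subset using (Subset; ⊥)
open import Data.List using (List; []; _∷_; length; map; allFin)
open import Data.List.Properties using (length-map; length-tabulate)
open import Data.List.Relation.Unary.All as All using (All; []; _∷_)
open import Data.List.Relation.Unary.All.Properties using (¬Any⇒All¬)
open import Data.List.Relation.Unary.Any using (Any; here; there; any?)
open import Data.List.Relation.Binary.Permutation.Propositional using (_↭_; ↭-refl; ↭-trans; prep; swap)
open import Data.List.Relation.Binary.Permutation.Propositional.Properties using (↭-length)
open import Data.Product using (Σ; _×_; _,_; ∃₂)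
open import Data.Sum using (_⊎_; inj₁; inj₂)
open import Function using (id)
open import Relation.Binary.PropositionalEquality using (_≡_; refl; sym; trans; cong; subst; subst₂; module ≡-Reasoning)
open import Relation.Nullary using (¬_; yes; no)

-- It is proved by smoothing: if some entry
-- s + p exceeds s, some other entry y is below s, and replacing the pair by
-- (s, p + y) keeps the sum while not decreasing the product, because
-- (s + p) y ≤ s (p + y) as soon as y ≤ s. Peeling off the entry s reduces
-- the length.

Any⇒∃↭∷ : ∀ {A : Set} {P : A → Set} {xs : List A} → Any P xs → ∃₂ λ x ys → P x × xs ↭ x ∷ ys
Any⇒∃↭∷ (here {x} {xs} px) = x , xs , px , ↭-refl
Any⇒∃↭∷ (there {y} p) with x , ys , px , xs↭x∷ys ← Any⇒∃↭∷ p =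
  x , y ∷ ys , px , ↭-trans (prep y xs↭x∷ys) (swap y x ↭-refl)

all≤⊎any> : ∀ s xs → All (_≤ s) xs ⊎ Any (s <_) xs
all≤⊎any> s xs with any? (s <?_) xs
... | yes some> = inj₂ some>
... | no none> = inj₁ (All.map ≮⇒≥ (¬Any⇒All¬ xs none>))

<-+-cancel : ∀ {a b c x} → a < x → x + b ≤ a + c → b < c
<-+-cancel {a} {b} {c} {x} a<x x+b≤a+c =
  +-cancelˡ-< a b c (<-≤-trans (+-monoˡ-< b a<x) x+b≤a+c)

any<-of-sum< : ∀ {s} xs → sum xs < length xs * s → Any (_< s) xs
any<-of-sum< {s} (x ∷ xs) Σ< with x <? s
... | yes x<s = here x<s
... | no x≮s = there (any<-of-sum< xs (+-cancelˡ-< s (sum xs) (length xs * s)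
                        (≤-<-trans (+-monoˡ-≤ (sum xs) (≮⇒≥ x≮s)) Σ<)))

sum≤length*-↭ : ∀ {s xs ys} → xs ↭ ys → sum xs ≤ length xs * s → sum ys ≤ length ys * s
sum≤length*-↭ {s} xs↭ys Σ≤ =
  subst₂ (λ σ l → σ ≤ l * s) (sum-↭ xs↭ys) (↭-length xs↭ys) Σ≤

product≤^length : ∀ {s xs} → All (_≤ s) xs → product xs ≤ s ^ length xs
product≤^length [] = ≤-refl
product≤^length (x≤s ∷ xs≤s) = *-mono-≤ x≤s (product≤^length xs≤s)

record ExcessDeficitPair (s : ℕ) (xs : List ℕ) : Set where
  constructor excess-deficit
  field
    excess deficit : ℕ
    rest : List ℕ
    deficit≤s : deficit ≤ s
    split : xs ↭ (s + excess) ∷ deficit ∷ rest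

find-excess-deficit : ∀ {s xs} → sum xs ≤ length xs * s → Any (s <_) xs
  → ExcessDeficitPair s xs
find-excess-deficit Σ≤ some>
  with x , ys , s<x , xs↭x∷ys ← Any⇒∃↭∷ some>
  with p , refl ← m≤n⇒∃[o]m+o≡n (<⇒≤ s<x)
  with y , zs , y<s , ys↭y∷zs ← Any⇒∃↭∷ (any<-of-sum< ys (<-+-cancel s<x (sum≤length*-↭ xs↭x∷ys Σ≤)))
  = excess-deficit p y zs (<⇒≤ y<s) (↭-trans xs↭x∷ys (prep _ ys↭y∷zs))

*-smoothing : ∀ s p y → y ≤ s → (s + p) * y ≤ s * (p + y)
*-smoothing s p y y≤s = begin
  (s + p) * y    ≡⟨ *-distribʳ-+ y s p ⟩
  s * y + p * y  ≤⟨ +-monoʳ-≤ (s * y) (*-monoʳ-≤ p y≤s) ⟩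
  s * y + p * s  ≡⟨ cong (s * y +_) (*-comm p s) ⟩
  s * y + s * p  ≡⟨ +-comm (s * y) (s * p) ⟩
  s * p + s * y  ≡⟨ *-distribˡ-+ s p y ⟨
  s * (p + y)    ∎
  where open ≤-Reasoning

sum-smoothing : ∀ s p y zs → sum ((s + p) ∷ y ∷ zs) ≡ s + sum ((p + y) ∷ zs)
sum-smoothing s p y zs = begin
  (s + p) + (y + sum zs)  ≡⟨ +-assoc s p (y + sum zs) ⟩
  s + (p + (y + sum zs))  ≡⟨ cong (s +_) (+-assoc p y (sum zs)) ⟨
  s + ((p + y) + sum zs)  ∎
  where open ≡-Reasoning

product-smoothing : ∀ s p {y} zs → y ≤ s
  → product ((s + p) ∷ y ∷ zs) ≤ s * product ((p + y) ∷ zs)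
product-smoothing s p {y} zs y≤s = begin
  (s + p) * (y * product zs)  ≡⟨ *-assoc (s + p) y (product zs) ⟨
  ((s + p) * y) * product zs  ≤⟨ *-monoˡ-≤ (product zs) (*-smoothing s p y y≤s) ⟩
  (s * (p + y)) * product zs  ≡⟨ *-assoc s (p + y) (product zs) ⟩
  s * ((p + y) * product zs)  ∎
  where open ≤-Reasoning

product≤^length-of-sum≤ : ∀ s xs → sum xs ≤ length xs * s → product xs ≤ s ^ length xs
product≤^length-of-sum≤ s xs = with-measure (length xs) xs refl
  where
  with-measure : ∀ m xs → length xs ≡ m → sum xs ≤ length xs * s → product xs ≤ s ^ length xs
  with-measure m xs len Σ≤ with all≤⊎any> s xs
  ... | inj₁ all≤ = product≤^length all≤
  with-measure zero [] _ _ | inj₂ ()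
  with-measure (suc m) xs len Σ≤ | inj₂ some>
    with excess-deficit p y zs y≤s xs↭ws ← find-excess-deficit Σ≤ some> = begin
      product xs                    ≡⟨ product-↭ xs↭ws ⟩
      product ((s + p) ∷ y ∷ zs)    ≤⟨ product-smoothing s p zs y≤s ⟩
      s * product ((p + y) ∷ zs)    ≤⟨ *-monoʳ-≤ s (with-measure m ((p + y) ∷ zs) len′ Σ≤′) ⟩
      s ^ length ((s + p) ∷ y ∷ zs) ≡⟨ cong (s ^_) (↭-length xs↭ws) ⟨
      s ^ length xs                 ∎
    where
    open ≤-Reasoning
    len′ : length ((p + y) ∷ zs) ≡ m
    len′ = suc-injective (trans (sym (↭-length xs↭ws)) len)
    Σ≤′ : sum ((p + y) ∷ zs) ≤ length ((p + y) ∷ zs) * s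
    Σ≤′ = +-cancelˡ-≤ s _ _
      (subst (_≤ length ((s + p) ∷ y ∷ zs) * s) (sum-smoothing s p y zs) (sum≤length*-↭ xs↭ws Σ≤))

prodFin≤^-of-sumFin≤ : ∀ {k} s (f : Fin k → ℕ) → sumFin f ≤ k * s → prodFin f ≤ s ^ k
prodFin≤^-of-sumFin≤ {k} s f Σ≤ =
  subst (λ l → prodFin f ≤ s ^ l) length≡k
    (product≤^length-of-sum≤ s (map f (allFin k)) (subst (λ l → sumFin f ≤ l * s) (sym length≡k) Σ≤))
  where
  length≡k : length (map f (allFin k)) ≡ k
  length≡k = trans (length-map f (allFin k)) (length-tabulate id)

proposition3p3 : (n : ℕ) → 1 ≤ n → (H : Family n) → Hereditary H
    → Σ (Subset n) (λ X → H X ≡ true)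
    → ¬ (∀ X → (H X ≡ true → X ≡ ⊥) × (X ≡ ⊥ → H X ≡ true))
    → (k : ℕ) → n + 1 ≤ k
    → (x : Fin n) → IsLargestStar H x
    → (∀ (B : Fin k → Family n) → (∀ i → SubFamily (B i) H) → CrossIntersecting B
    → sumFin (λ i → size (B i)) ≤ k * size (star H x))
    → ∀ (A : Fin k → Family n) → (∀ i → SubFamily (A i) H) → CrossIntersecting A
    → prodFin (λ i → size (A i)) ≤ size (star H x) ^ k
proposition3p3 n _ H _ _ _ k _ x _ sum≤ A A⊆H A-cross =
  prodFin≤^-of-sumFin≤ (size (star H x)) (λ i → size (A i)) (sum≤ A A⊆H A-cross)
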